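{- Let $G$ be an ordered graph and let $A,B\subseteq V(G)$ be disjoint cliques with $A<B$. Let $\gamma>0$. If $G[A\cup B]$ contains at most $\gamma^2|A|^2|B|/4$ induced copies of $D$, then $G[A\cup B]$ can be made induced $D$-free by adding/deleting at most $\gamma|A||B|$ edges between $A$ and $B$.
   Context: An ordered graph is a graph with a linear order on its vertex set. $D$ is the ordered graph with vertices $x<y<z$ and edges $\{x,y\},\{x,z\}$; an induced copy of $D$ is a triple $u<v<w$ with $\{u,v\},\{u,w\}$ edges and $\{v,w\}$ a non-edge; induced $D$-free means containing no such triple. $A<B$ means $a<b$ for all $a\in A$, $b\in B$.
   Formalization: The parameter γ ranges over the positive rationals. -}

module Defs where

open import Data.Nat using (ℕ; zero; suc; _+_; _*_)
open import Data.Bool using (Bool; true; false; _∧_; not; if_then_else_)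
open import Data.Fin using (Fin; _<_)
open import Data.Fin.Subset using (Subset; _∈_; _∪_)
open import Data.List using (List; map; allFin)
open import Data.Nat.ListAction using (sum)
open import Relation.Binary.PropositionalEquality using (_≡_; _≢_)
open import Relation.Nullary using (¬_; does)
open import Data.Fin.Properties using (_<?_)
open import Data.Fin.Subset.Properties using (_∈?_)
open import Data.Product using (_×_)

-- An ordered (finite simple) graph: vertex set Fin n, ordered by the
-- natural order of Fin n; decidable symmetric irreflexive adjacency.
record OrderedGraph (n : ℕ) : Set where
  field
    adj   : Fin n → Fin n → Bool
    sym   : ∀ u v → adj u v ≡ adj v u
    irrefl : ∀ u → adj u u ≡ false
open OrderedGraph public

Edge : ∀ {n} → OrderedGraph n → Fin n → Fin n → Set
Edge G u v = adj G u v ≡ true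

IsClique : ∀ {n} → OrderedGraph n → Subset n → Set
IsClique G S = ∀ u v → u ∈ S → v ∈ S → u ≢ v → Edge G u v

_<ˢ_ : ∀ {n} → Subset n → Subset n → Set
A <ˢ B = ∀ a b → a ∈ A → b ∈ B → a < b

Disjoint : ∀ {n} → Subset n → Subset n → Set
Disjoint A B = ∀ v → v ∈ A → v ∈ B → Data.Empty.⊥
  where import Data.Empty

Σv : ∀ {n} → (Fin n → ℕ) → ℕ
Σv {n} f = sum (map f (allFin n))

b2n : Bool → ℕ
b2n true = 1
b2n false = 0

-- indicator that u<v<w, all in S, is an induced copy of D in G
isInducedD : ∀ {n} → OrderedGraph n → Subset n → Fin n → Fin n → Fin n → Bool
isInducedD G S u v w =
  does (u ∈? S) ∧ does (v ∈? S) ∧ does (w ∈? S) ∧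
  does (u <? v) ∧ does (v <? w) ∧
  adj G u v ∧ adj G u w ∧ not (adj G v w)

countD : ∀ {n} → OrderedGraph n → Subset n → ℕ
countD G S = Σv λ u → Σv λ v → Σv λ w → b2n (isInducedD G S u v w)

InducedDFree : ∀ {n} → OrderedGraph n → Subset n → Set
InducedDFree G S = ∀ u v w → u ∈ S → v ∈ S → w ∈ S → u < v → v < w →
  Edge G u v → Edge G u w → Edge G v w

OnlyChangesBetween : ∀ {n} → OrderedGraph n → OrderedGraph n → Subset n → Subset n → Set
OnlyChangesBetween G H A B = ∀ u v → ¬ ((u ∈ A × v ∈ B) Data.Sum.⊎ (v ∈ A × u ∈ B)) →
  adj G u v ≡ adj H u v
  where import Data.Sum

changesBetween : ∀ {n} → OrderedGraph n → OrderedGraph n → Subset n → Subset n → ℕ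
changesBetween G H A B = Σv λ a → Σv λ b →
  b2n (does (a ∈? A) ∧ does (b ∈? B) ∧ not (eqB (adj G a b) (adj H a b)))
  where
  eqB : Bool → Bool → Bool
  eqB true true = true
  eqB false false = true
  eqB _ _ = false

-- For every w ∈ B, read the adjacencies of the vertices of A (in the order of A) to w as a
-- 0/1 column. G[A ∪ B] is induced D-free exactly when every column is monotone, i.e. the
-- neighbours of w in A form an up-set of A. An induced copy u < v < w of D with u, v ∈ A and
-- w ∈ B is an inversion (a 1 above a 0) of the column of w, so the total number K of such
-- inversions is at most the number of induced copies of D. A column with K_w inversions can be
-- made monotone with at most α/β + (β/α) K_w changes, for any α, β > 0: cut the column at its
-- (⌊α/β⌋ + 1)-st one and flip the ones before the cut and the zeros after it. Summing over
-- w ∈ B and choosing α/β = γ|A|/2 turns the hypothesis K ≤ γ²|A|²|B|/4 into at most γ|A||B|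
-- changes.
module Submission where

module FinSum where
  open import Data.Nat using (ℕ; zero; suc; _+_; _≤_; z≤n)
  open import Data.Nat.Properties using (+-mono-≤; +-*-semiring)
  open import Data.Bool using (Bool)
  open import Data.Fin using (Fin; zero; suc)
  open import Data.Fin.Subset using (Subset; ∣_∣; inside; outside)
  open import Data.Fin.Subset.Properties using (_∈?_)
  open import Data.Vec using ([]; _∷_)
  open import Data.List using (tabulate)
  open import Data.List.Properties using (map-tabulate)
  import Data.Nat.ListAction as List
  open import Relation.Binary.PropositionalEquality using (_≡_; refl; cong; trans)
  open import Relation.Nullary using (does)
  open import Defs using (Σv; b2n)

  open import Algebra.Properties.Semiring.Sum +-*-semiring public
    using (sum; sum-syntax; sum-cong-≗; ∑-distrib-+; ∑-comm; *-distribˡ-sum; *-distribʳ-sum)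

  sum-mono-≤ : ∀ {m} {f g : Fin m → ℕ} → (∀ i → f i ≤ g i) → sum f ≤ sum g
  sum-mono-≤ {zero}  f≤g = z≤n
  sum-mono-≤ {suc m} f≤g = +-mono-≤ (f≤g zero) (sum-mono-≤ (λ i → f≤g (suc i)))

  sum-tabulate : ∀ {m} (f : Fin m → ℕ) → List.sum (tabulate f) ≡ sum f
  sum-tabulate {zero}  f = refl
  sum-tabulate {suc m} f = cong (f zero +_) (sum-tabulate (λ i → f (suc i)))

  Σv≡sum : ∀ {m} (f : Fin m → ℕ) → Σv f ≡ sum f
  Σv≡sum f = trans (cong List.sum (map-tabulate (λ i → i) f)) (sum-tabulate f)

  Σv²≡∑² : ∀ {m} (f : Fin m → Fin m → ℕ) → Σv (λ i → Σv (f i)) ≡ ∑[ i < m ] ∑[ j < m ] f i j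
  Σv²≡∑² f = trans (Σv≡sum (λ i → Σv (f i))) (sum-cong-≗ λ i → Σv≡sum (f i))

  Σv³≡∑³ : ∀ {m} (f : Fin m → Fin m → Fin m → ℕ) →
    Σv (λ i → Σv (λ j → Σv (f i j))) ≡ ∑[ i < m ] ∑[ j < m ] ∑[ k < m ] f i j k
  Σv³≡∑³ f = trans (Σv≡sum (λ i → Σv (λ j → Σv (f i j)))) (sum-cong-≗ λ i → Σv²≡∑² (f i))

  _∈ᵇ_ : ∀ {m} → Fin m → Subset m → Bool
  u ∈ᵇ S = does (u ∈? S)

  indicator : ∀ {m} → Subset m → Fin m → ℕ
  indicator S u = b2n (u ∈ᵇ S)

  ∣p∣≡∑indicator : ∀ {m} (p : Subset m) → ∣ p ∣ ≡ ∑[ i < m ] indicator p i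
  ∣p∣≡∑indicator []            = refl
  ∣p∣≡∑indicator (inside  ∷ p) = cong suc (∣p∣≡∑indicator p)
  ∣p∣≡∑indicator (outside ∷ p) = ∣p∣≡∑indicator p

module Threshold where
  open import Data.Nat using (ℕ; zero; suc; _+_; _*_; _≤_; z≤n; s≤s; _≤?_)
  open import Data.Nat.Properties
    using (+-mono-≤; +-monoʳ-≤; +-monoˡ-≤; *-monoʳ-≤; *-monoˡ-≤; m≤m+n; m≤n+m; ≤-trans; <⇒≤; ≰⇒>;
           +-identityʳ; *-zeroʳ; ≤-reflexive; module ≤-Reasoning)
  open import Data.Nat.Tactic.RingSolver using (solve)
  open import Data.List using ([]; _∷_)
  open import Data.Bool using (Bool; true; false; _∧_; not; _xor_)
  open import Data.Fin as Fin using (Fin; zero; suc)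
  open import Data.Fin.Properties using (_<?_)
  open import Data.Product using (∃-syntax; _,_)
  import Data.Product as Product
  open import Relation.Binary.PropositionalEquality using (_≡_; refl; cong; subst₂)
  open import Relation.Nullary using (does; yes; no)
  open import Function using (_∘_)
  open import Defs using (b2n)
  open FinSum

  upFrom : ∀ {m} → ℕ → Fin m → Bool
  upFrom zero    _       = true
  upFrom (suc t) zero    = false
  upFrom (suc t) (suc u) = upFrom t u

  upFrom-mono : ∀ {m} t {u v : Fin m} → u Fin.≤ v → upFrom t u ≡ true → upFrom t v ≡ true
  upFrom-mono zero    _                      _  = refl
  upFrom-mono (suc t) {suc u} {suc v} (s≤s u≤v) eq = upFrom-mono t u≤v eq

  module _ {m} (S g : Fin m → Bool) where

    mismatches : (Fin m → Bool) → ℕ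
    mismatches h = ∑[ u < m ] b2n (S u ∧ (h u xor g u))

    zeros : ℕ
    zeros = ∑[ u < m ] b2n (S u ∧ not (g u))

    inversions : ℕ
    inversions = ∑[ u < m ] ∑[ v < m ] b2n (does (u <? v) ∧ S u ∧ S v ∧ g u ∧ not (g v))

  private
    stop-bound : ∀ α β p Z K → β * p ≤ α → α ≤ β * suc p →
      α * β * (p + Z) ≤ α * α + β * β * ((Z + K) + p * Z)
    stop-bound α β p Z K βp≤α α≤β[1+p] = begin
      α * β * (p + Z)
        ≡⟨ solve (α ∷ β ∷ p ∷ Z ∷ []) ⟩
      α * (β * p) + β * (α * Z)
        ≤⟨ +-mono-≤ (*-monoʳ-≤ α βp≤α) (*-monoʳ-≤ β (*-monoˡ-≤ Z α≤β[1+p])) ⟩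
      α * α + β * (β * suc p * Z)
        ≡⟨ solve (α ∷ β ∷ p ∷ Z ∷ []) ⟩
      α * α + β * β * (Z + p * Z)
        ≤⟨ +-monoʳ-≤ (α * α) (*-monoʳ-≤ (β * β) (+-monoˡ-≤ (p * Z) (m≤m+n Z K))) ⟩
      α * α + β * β * ((Z + K) + p * Z) ∎
      where open ≤-Reasoning

    continue-bound : ∀ α β p M Z K → α * β * (suc p + M) ≤ α * α + β * β * (K + suc p * Z) →
      α * β * (p + suc M) ≤ α * α + β * β * ((Z + K) + p * Z)
    continue-bound α β p M Z K =
      subst₂ _≤_ (solve (α ∷ β ∷ p ∷ M ∷ [])) (solve (α ∷ β ∷ p ∷ Z ∷ K ∷ []))

    bound-mono : ∀ α β p {K K′ Z Z′} → K ≤ K′ → Z ≤ Z′ →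
      α * α + β * β * (K + p * Z) ≤ α * α + β * β * (K′ + p * Z′)
    bound-mono α β p K≤K′ Z≤Z′ =
      +-monoʳ-≤ (α * α) (*-monoʳ-≤ (β * β) (+-mono-≤ K≤K′ (*-monoʳ-≤ p Z≤Z′)))

  -- p ones have been passed before the column starts: a later threshold flips each of them,
  -- and each of them forms an inversion with every zero of the column. The threshold is put
  -- at the first one that would make β * p exceed α.
  threshold-bound′ : ∀ {m} (S g : Fin m → Bool) α β p → β * p ≤ α →
    ∃[ t ] α * β * (p + mismatches S g (upFrom t)) ≤ α * α + β * β * (inversions S g + p * zeros S g)
  threshold-bound′ {zero} S g α β p βp≤α = 0 , (begin
    α * β * (p + 0)              ≡⟨ solve (α ∷ β ∷ p ∷ []) ⟩
    α * (β * p)                  ≤⟨ *-monoʳ-≤ α βp≤α ⟩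
    α * α                        ≤⟨ m≤m+n (α * α) _ ⟩
    α * α + β * β * (0 + p * 0)  ∎)
    where open ≤-Reasoning
  threshold-bound′ {suc m} S g α β p βp≤α with S zero | g zero
  ... | false | _     = Product.map suc (λ ih → ≤-trans ih (bound-mono α β p (m≤n+m _ _) (m≤n+m _ _)))
                                        (threshold-bound′ (S ∘ suc) (g ∘ suc) α β p βp≤α)
  ... | true  | false = Product.map suc (λ ih → ≤-trans ih (bound-mono α β p (m≤n+m _ _) (m≤n+m _ _)))
                                        (threshold-bound′ (S ∘ suc) (g ∘ suc) α β p βp≤α)
  ... | true  | true  with β * suc p ≤? α
  ...   | yes β[1+p]≤α = Product.map suc (continue-bound α β p _ _ _)
                                         (threshold-bound′ (S ∘ suc) (g ∘ suc) α β (suc p) β[1+p]≤α)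
  ...   | no  β[1+p]≰α = 0 , stop-bound α β p _ _ βp≤α (<⇒≤ (≰⇒> β[1+p]≰α))

  threshold-bound : ∀ {m} (S g : Fin m → Bool) α β →
    ∃[ t ] α * β * mismatches S g (upFrom t) ≤ α * α + β * β * inversions S g
  threshold-bound S g α β =
    Product.map₂ (subst₂ _≤_ refl (cong (λ K → α * α + β * β * K) (+-identityʳ _)))
                 (threshold-bound′ S g α β 0 (≤-trans (≤-reflexive (*-zeroʳ β)) z≤n))

module Rewiring where
  open import Data.Nat using (ℕ)
  import Data.Nat.Properties as ℕ
  open import Data.Bool using (Bool; false)
  open import Data.Fin using (Fin)
  open import Data.Fin.Properties using (<⇒≢; <-asym)
  open import Data.Fin.Subset using (Subset; _∈_; _∪_)
  open import Data.Fin.Subset.Properties using (_∈?_; x∈p∪q⁻)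
  open import Data.Product using (_×_; _,_)
  open import Data.Sum using (inj₁; inj₂)
  open import Data.Empty using (⊥-elim)
  open import Relation.Binary.PropositionalEquality using (_≡_; refl; trans; sym)
  open import Relation.Nullary using (Dec; yes; no)
  open import Relation.Nullary.Decidable using (_×-dec_)
  open import Defs renaming (sym to adj-sym; irrefl to adj-irrefl)
  open Threshold using (upFrom; upFrom-mono)

  module _ {n} (G : OrderedGraph n) {A B : Subset n} (A∩B=∅ : Disjoint A B) where

    crossing? : ∀ u v → Dec (u ∈ A × v ∈ B)
    crossing? u v = u ∈? A ×-dec v ∈? B

    rewire : (Fin n → Fin n → Bool) → OrderedGraph n
    rewire f = record { adj = adj′ ; sym = sym′ ; irrefl = irrefl′ }
      where
      adj′ : Fin n → Fin n → Bool
      adj′ u v with crossing? u v | crossing? v u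
      ... | yes _ | _     = f u v
      ... | no _  | yes _ = f v u
      ... | no _  | no _  = adj G u v

      sym′ : ∀ u v → adj′ u v ≡ adj′ v u
      sym′ u v with crossing? u v | crossing? v u
      ... | yes (u∈A , _) | yes (_ , u∈B) = ⊥-elim (A∩B=∅ u u∈A u∈B)
      ... | yes _         | no _          = refl
      ... | no _          | yes _         = refl
      ... | no _          | no _          = adj-sym G u v

      irrefl′ : ∀ u → adj′ u u ≡ false
      irrefl′ u with crossing? u u
      ... | yes (u∈A , u∈B) = ⊥-elim (A∩B=∅ u u∈A u∈B)
      ... | no _            = adj-irrefl G u

    rewire-crossing : ∀ f {a b} → a ∈ A → b ∈ B → adj (rewire f) a b ≡ f a b
    rewire-crossing f {a} {b} a∈A b∈B with crossing? a b
    ... | yes _   = refl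
    ... | no ¬a×b = ⊥-elim (¬a×b (a∈A , b∈B))

    rewire-onlyChangesBetween : ∀ f → OnlyChangesBetween G (rewire f) A B
    rewire-onlyChangesBetween f u v ¬between with crossing? u v | crossing? v u
    ... | yes u×v | _       = ⊥-elim (¬between (inj₁ u×v))
    ... | no _    | yes v×u = ⊥-elim (¬between (inj₂ v×u))
    ... | no _    | no _    = refl

    rewire-within-A : ∀ f {u v} → u ∈ A → v ∈ A → adj (rewire f) u v ≡ adj G u v
    rewire-within-A f {u} {v} u∈A v∈A = sym (rewire-onlyChangesBetween f u v
      λ { (inj₁ (_ , v∈B)) → A∩B=∅ v v∈A v∈B ; (inj₂ (_ , u∈B)) → A∩B=∅ u u∈A u∈B })

    rewire-within-B : ∀ f {u v} → u ∈ B → v ∈ B → adj (rewire f) u v ≡ adj G u v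
    rewire-within-B f {u} {v} u∈B v∈B = sym (rewire-onlyChangesBetween f u v
      λ { (inj₁ (u∈A , _)) → A∩B=∅ u u∈A u∈B ; (inj₂ (v∈A , _)) → A∩B=∅ v v∈A v∈B })

    thresholdRewire : (Fin n → ℕ) → OrderedGraph n
    thresholdRewire t = rewire (λ a b → upFrom (t b) a)

    thresholdRewire-inducedDFree : IsClique G A → IsClique G B → A <ˢ B →
      ∀ t → InducedDFree (thresholdRewire t) (A ∪ B)
    thresholdRewire-inducedDFree A-clique B-clique A<B t u v w u∈S v∈S w∈S u<v v<w uv uw
      with x∈p∪q⁻ A B v∈S | x∈p∪q⁻ A B w∈S
    ... | inj₁ v∈A | inj₁ w∈A = trans (rewire-within-A _ v∈A w∈A) (A-clique v w v∈A w∈A (<⇒≢ v<w))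
    ... | inj₂ v∈B | inj₂ w∈B = trans (rewire-within-B _ v∈B w∈B) (B-clique v w v∈B w∈B (<⇒≢ v<w))
    ... | inj₂ v∈B | inj₁ w∈A = ⊥-elim (<-asym v<w (A<B w v w∈A v∈B))
    ... | inj₁ v∈A | inj₂ w∈B with x∈p∪q⁻ A B u∈S
    ...   | inj₂ u∈B = ⊥-elim (<-asym u<v (A<B v u v∈A u∈B))
    ...   | inj₁ u∈A = trans (rewire-crossing _ v∈A w∈B)
                         (upFrom-mono (t w) (ℕ.<⇒≤ u<v) (trans (sym (rewire-crossing _ u∈A w∈B)) uw))

module Counting where
  open import Data.Nat using (ℕ; _*_; _≤_; z≤n; s≤s)
  open import Data.Nat.Properties using (*-identityˡ; *-zeroʳ; ≤-reflexive; module ≤-Reasoning)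
  open import Data.Bool using (Bool; true; false; _∧_; not; _xor_)
  open import Data.Fin using (Fin)
  open import Data.Fin.Properties using (_<?_; <⇒≢)
  open import Data.Fin.Subset using (Subset; _∪_; ∣_∣)
  open import Data.Fin.Subset.Properties using (_∈?_; x∈p∪q⁺)
  open import Data.Sum using (inj₁; inj₂)
  open import Data.Product using (Σ; _,_; proj₁)
  open import Relation.Binary.PropositionalEquality using (_≡_; refl; cong₂; trans; sym; module ≡-Reasoning)
  open import Relation.Nullary using (yes; no; does)
  open import Relation.Nullary.Decidable using (dec-true; dec-false)
  open import Defs hiding (sym; irrefl)
  open FinSum
  open Threshold using (mismatches; inversions)
  open Rewiring using (rewire)

  b2n≤1 : ∀ x → b2n x ≤ 1
  b2n≤1 true  = s≤s z≤n
  b2n≤1 false = z≤n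

  column : ∀ {n} → OrderedGraph n → Fin n → Fin n → Bool
  column G w u = adj G u w

  module _ {n} (A B : Subset n) where

    private
      -- The comparison inside changesBetween is local to Defs, so its summand can only be
      -- named through the defining equation.
      changesBetween-summand : ∀ G H →
        Σ (Fin n → Fin n → ℕ) λ d → changesBetween G H A B ≡ Σv (λ a → Σv (d a))
      changesBetween-summand G H = _ , refl

    changesBetween≡sum : ∀ G H → changesBetween G H A B ≡
      ∑[ a < n ] ∑[ b < n ] b2n (a ∈ᵇ A ∧ b ∈ᵇ B ∧ (adj H a b xor adj G a b))
    changesBetween≡sum G H =
      trans (Σv²≡∑² (proj₁ (changesBetween-summand G H))) (sum-cong-≗ λ a → sum-cong-≗ (pointwise a))
      where
      pointwise : ∀ a b → proj₁ (changesBetween-summand G H) a b ≡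
                          b2n (a ∈ᵇ A ∧ b ∈ᵇ B ∧ (adj H a b xor adj G a b))
      pointwise a b with adj G a b | adj H a b
      ... | true  | true  = refl
      ... | true  | false = refl
      ... | false | true  = refl
      ... | false | false = refl

    changesBetween-≤ : ∀ G H → changesBetween G H A B ≤ ∣ A ∣ * ∣ B ∣
    changesBetween-≤ G H = begin
      changesBetween G H A B
        ≡⟨ changesBetween≡sum G H ⟩
      ∑[ a < n ] ∑[ b < n ] _
        ≤⟨ sum-mono-≤ (λ a → sum-mono-≤ (pointwise a)) ⟩
      ∑[ a < n ] ∑[ b < n ] (indicator A a * indicator B b)
        ≡⟨ sum-cong-≗ (λ a → sym (*-distribˡ-sum (indicator A a) (indicator B))) ⟩
      ∑[ a < n ] (indicator A a * ∑[ b < n ] indicator B b)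
        ≡⟨ sym (*-distribʳ-sum _ (indicator A)) ⟩
      (∑[ a < n ] indicator A a) * (∑[ b < n ] indicator B b)
        ≡⟨ sym (cong₂ _*_ (∣p∣≡∑indicator A) (∣p∣≡∑indicator B)) ⟩
      ∣ A ∣ * ∣ B ∣ ∎
      where
      open ≤-Reasoning
      pointwise : ∀ a b →
        b2n (a ∈ᵇ A ∧ b ∈ᵇ B ∧ (adj H a b xor adj G a b)) ≤ indicator A a * indicator B b
      pointwise a b with a ∈? A | b ∈? B
      ... | yes _ | yes _ = b2n≤1 _
      ... | yes _ | no _  = z≤n
      ... | no _  | _     = z≤n

    changesBetween-rewire : ∀ G (A∩B=∅ : Disjoint A B) f → changesBetween G (rewire G A∩B=∅ f) A B ≡
      ∑[ b < n ] (indicator B b * mismatches (_∈ᵇ A) (column G b) (λ a → f a b))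
    changesBetween-rewire G A∩B=∅ f = begin
      changesBetween G H A B
        ≡⟨ changesBetween≡sum G H ⟩
      ∑[ a < n ] ∑[ b < n ] _
        ≡⟨ sum-cong-≗ (λ a → sum-cong-≗ (pointwise a)) ⟩
      ∑[ a < n ] ∑[ b < n ] (indicator B b * mismatch a b)
        ≡⟨ ∑-comm (λ a b → indicator B b * mismatch a b) ⟩
      ∑[ b < n ] ∑[ a < n ] (indicator B b * mismatch a b)
        ≡⟨ sum-cong-≗ (λ b → sym (*-distribˡ-sum (indicator B b) (λ a → mismatch a b))) ⟩
      ∑[ b < n ] (indicator B b * mismatches (_∈ᵇ A) (column G b) (λ a → f a b)) ∎
      where
      open ≡-Reasoning
      H = rewire G A∩B=∅ f
      mismatch : Fin n → Fin n → ℕ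
      mismatch a b = b2n (a ∈ᵇ A ∧ (f a b xor adj G a b))
      pointwise : ∀ a b →
        b2n (a ∈ᵇ A ∧ b ∈ᵇ B ∧ (adj H a b xor adj G a b)) ≡ indicator B b * mismatch a b
      pointwise a b with a ∈? A | b ∈? B
      ... | yes _ | yes _ = sym (*-identityˡ _)
      ... | yes _ | no _  = refl
      ... | no _  | b∈?B  = sym (*-zeroʳ (b2n (does b∈?B)))

    inversions-≤-countD : ∀ G → IsClique G A → A <ˢ B →
      ∑[ w < n ] (indicator B w * inversions (_∈ᵇ A) (column G w)) ≤ countD G (A ∪ B)
    inversions-≤-countD G A-clique A<B = begin
      ∑[ w < n ] (indicator B w * ∑[ u < n ] ∑[ v < n ] inv w u v)
        ≡⟨ sum-cong-≗ (λ w → trans (*-distribˡ-sum (indicator B w) (λ u → ∑[ v < n ] inv w u v))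
                                   (sum-cong-≗ λ u → *-distribˡ-sum (indicator B w) (inv w u))) ⟩
      ∑[ w < n ] ∑[ u < n ] ∑[ v < n ] (indicator B w * inv w u v)
        ≡⟨ ∑-comm (λ w u → ∑[ v < n ] (indicator B w * inv w u v)) ⟩
      ∑[ u < n ] ∑[ w < n ] ∑[ v < n ] (indicator B w * inv w u v)
        ≡⟨ sum-cong-≗ (λ u → ∑-comm (λ w v → indicator B w * inv w u v)) ⟩
      ∑[ u < n ] ∑[ v < n ] ∑[ w < n ] (indicator B w * inv w u v)
        ≤⟨ sum-mono-≤ (λ u → sum-mono-≤ (λ v → sum-mono-≤ (pointwise u v))) ⟩
      ∑[ u < n ] ∑[ v < n ] ∑[ w < n ] b2n (isInducedD G (A ∪ B) u v w)
        ≡⟨ sym (Σv³≡∑³ (λ u v w → b2n (isInducedD G (A ∪ B) u v w))) ⟩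
      countD G (A ∪ B) ∎
      where
      open ≤-Reasoning
      inv : Fin n → Fin n → Fin n → ℕ
      inv w u v = b2n (does (u <? v) ∧ u ∈ᵇ A ∧ v ∈ᵇ A ∧ adj G u w ∧ not (adj G v w))
      pointwise : ∀ u v w → indicator B w * inv w u v ≤ b2n (isInducedD G (A ∪ B) u v w)
      pointwise u v w with w ∈? B | u <? v | u ∈? A | v ∈? A
      ... | no _    | _       | _       | _       = z≤n
      ... | yes _   | no u≮v  | _       | _       rewrite dec-false (u <? v) u≮v = z≤n
      ... | yes _   | yes u<v | no _    | _       rewrite dec-true (u <? v) u<v = z≤n
      ... | yes _   | yes u<v | yes _   | no _    rewrite dec-true (u <? v) u<v = z≤n
      ... | yes w∈B | yes u<v | yes u∈A | yes v∈A
        rewrite dec-true (u <? v) u<v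
              | dec-true (u ∈? A ∪ B) (x∈p∪q⁺ (inj₁ u∈A))
              | dec-true (v ∈? A ∪ B) (x∈p∪q⁺ (inj₁ v∈A))
              | dec-true (w ∈? A ∪ B) (x∈p∪q⁺ (inj₂ w∈B))
              | dec-true (v <? w) (A<B v w v∈A w∈B)
              | A-clique u v u∈A v∈A (<⇒≢ u<v) = ≤-reflexive (*-identityˡ _)

module Repair where
  open import Data.Nat using (ℕ; _+_; _*_; _≤_)
  open import Data.Nat.Properties using (+-mono-≤; *-monoʳ-≤; ≤-reflexive; module ≤-Reasoning)
  open import Data.Nat.Tactic.RingSolver using (solve-∀)
  open import Data.Fin using (Fin)
  open import Data.Fin.Subset using (Subset; _∪_; ∣_∣)
  open import Data.Product using (Σ; _×_; _,_; proj₁; proj₂)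
  open import Relation.Binary.PropositionalEquality using (_≡_; cong; cong₂; sym; trans)
  open import Defs hiding (sym; irrefl)
  open FinSum
  open Threshold using (upFrom; mismatches; inversions; threshold-bound)
  open Rewiring using (thresholdRewire; rewire-onlyChangesBetween; thresholdRewire-inducedDFree)
  open Counting using (column; changesBetween-rewire; inversions-≤-countD)

  repair : ∀ {n} (G : OrderedGraph n) {A B : Subset n} →
    Disjoint A B → IsClique G A → IsClique G B → A <ˢ B → ∀ α β →
    Σ (OrderedGraph n) λ H →
      OnlyChangesBetween G H A B ×
      α * β * changesBetween G H A B ≤ α * α * ∣ B ∣ + β * β * countD G (A ∪ B) ×
      InducedDFree H (A ∪ B)
  repair {n} G {A} {B} A∩B=∅ A-clique B-clique A<B α β =
    H , rewire-onlyChangesBetween G A∩B=∅ _ , bound ,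
    thresholdRewire-inducedDFree G A∩B=∅ A-clique B-clique A<B t
    where
    column-bound : ∀ w → _
    column-bound w = threshold-bound (_∈ᵇ A) (column G w) α β

    t : Fin n → ℕ
    t w = proj₁ (column-bound w)

    H : OrderedGraph n
    H = thresholdRewire G A∩B=∅ t

    I M K : Fin n → ℕ
    I w = indicator B w
    M w = mismatches (_∈ᵇ A) (column G w) (upFrom (t w))
    K w = inversions (_∈ᵇ A) (column G w)

    commute : ∀ a i m → a * (i * m) ≡ i * (a * m)
    commute = solve-∀

    spread : ∀ a b i k → i * (a * a + b * b * k) ≡ a * a * i + b * b * (i * k)
    spread = solve-∀

    open ≤-Reasoning

    bound : α * β * changesBetween G H A B ≤ α * α * ∣ B ∣ + β * β * countD G (A ∪ B)
    bound = begin
      α * β * changesBetween G H A B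
        ≡⟨ cong (α * β *_) (changesBetween-rewire A B G A∩B=∅ _) ⟩
      α * β * ∑[ w < n ] (I w * M w)
        ≡⟨ trans (*-distribˡ-sum (α * β) (λ w → I w * M w))
                 (sum-cong-≗ λ w → commute (α * β) (I w) (M w)) ⟩
      ∑[ w < n ] (I w * (α * β * M w))
        ≤⟨ sum-mono-≤ (λ w → *-monoʳ-≤ (I w) (proj₂ (column-bound w))) ⟩
      ∑[ w < n ] (I w * (α * α + β * β * K w))
        ≡⟨ sum-cong-≗ (λ w → spread α β (I w) (K w)) ⟩
      ∑[ w < n ] (α * α * I w + β * β * (I w * K w))
        ≡⟨ ∑-distrib-+ (λ w → α * α * I w) (λ w → β * β * (I w * K w)) ⟩
      ∑[ w < n ] (α * α * I w) + ∑[ w < n ] (β * β * (I w * K w))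
        ≡⟨ sym (cong₂ _+_ (*-distribˡ-sum (α * α) I) (*-distribˡ-sum (β * β) (λ w → I w * K w))) ⟩
      α * α * ∑[ w < n ] I w + β * β * ∑[ w < n ] (I w * K w)
        ≤⟨ +-mono-≤ (≤-reflexive (cong (α * α *_) (sym (∣p∣≡∑indicator B))))
                    (*-monoʳ-≤ (β * β) (inversions-≤-countD A B G A-clique A<B)) ⟩
      α * α * ∣ B ∣ + β * β * countD G (A ∪ B) ∎

module Arithmetic where
  open import Data.Nat using (zero; suc; _+_; _*_; _≤_; z≤n; NonZero)
  open import Data.Nat.Properties using (*-cancelˡ-≤; +-monoʳ-≤; n≤0⇒n≡0; m*n≢0; module ≤-Reasoning)
  open import Data.Nat.Tactic.RingSolver using (solve)
  open import Data.List using ([]; _∷_)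

  balanced-bound : ∀ α β b C X .{{_ : NonZero α}} →
    α * β * C ≤ α * α * b + β * β * X → β * β * X ≤ α * α * b → β * C ≤ 2 * (α * b)
  balanced-bound α β b C X αβC≤ β²X≤α²b = *-cancelˡ-≤ α (begin
    α * (β * C)            ≡⟨ solve (α ∷ β ∷ C ∷ []) ⟩
    α * β * C              ≤⟨ αβC≤ ⟩
    α * α * b + β * β * X  ≤⟨ +-monoʳ-≤ (α * α * b) β²X≤α²b ⟩
    α * α * b + α * α * b  ≡⟨ solve (α ∷ b ∷ []) ⟩
    α * (2 * (α * b))      ∎)
    where open ≤-Reasoning

  private
    cross-multiplied-bound-nonZero : ∀ p q a b C X .{{_ : NonZero p}} .{{_ : NonZero a}} →
      p * a * (2 * q) * C ≤ p * a * (p * a) * b + 2 * q * (2 * q) * X →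
      X * (q * q * 4) ≤ p * p * (a * a * b) → C * q ≤ p * (a * b)
    cross-multiplied-bound-nonZero p q a b C X αβC≤ X≤ = *-cancelˡ-≤ 2 (begin
      2 * (C * q)        ≡⟨ solve (C ∷ q ∷ []) ⟩
      2 * q * C          ≤⟨ balanced-bound (p * a) (2 * q) b C X {{m*n≢0 p a}} αβC≤ β²X≤α²b ⟩
      2 * (p * a * b)    ≡⟨ solve (p ∷ a ∷ b ∷ []) ⟩
      2 * (p * (a * b))  ∎)
      where
      open ≤-Reasoning
      β²X≤α²b : 2 * q * (2 * q) * X ≤ p * a * (p * a) * b
      β²X≤α²b = begin
        2 * q * (2 * q) * X  ≡⟨ solve (q ∷ X ∷ []) ⟩
        X * (q * q * 4)      ≤⟨ X≤ ⟩
        p * p * (a * a * b)  ≡⟨ solve (p ∷ a ∷ b ∷ []) ⟩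
        p * a * (p * a) * b  ∎

  cross-multiplied-bound : ∀ p q a b C X .{{_ : NonZero p}} → C ≤ a * b →
    p * a * (2 * q) * C ≤ p * a * (p * a) * b + 2 * q * (2 * q) * X →
    X * (q * q * 4) ≤ p * p * (a * a * b) → C * q ≤ p * (a * b)
  cross-multiplied-bound p q zero      b C X C≤0 _ _ rewrite n≤0⇒n≡0 C≤0 = z≤n
  cross-multiplied-bound p q a@(suc _) b C X _       = cross-multiplied-bound-nonZero p q a b C X

module RationalBounds where
  open import Data.Nat using (ℕ; suc; _+_; _*_)
  import Data.Nat as ℕ
  import Data.Nat.Properties as ℕ
  open import Data.Nat.Coprimality using (Coprime)
  open import Data.Integer using (+_; +[1+_]; +0; -[1+_])
  import Data.Integer as ℤ
  import Data.Integer.Properties as ℤ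
  open import Data.Rational using (ℚ; mkℚ; 0ℚ; _/_; _≤_; _<_; toℚᵘ; positive)
  import Data.Rational as ℚ
  open import Data.Rational.Properties using (toℚᵘ-fromℚᵘ; toℚᵘ-homo-*; toℚᵘ-mono-≤; toℚᵘ-cancel-≤)
  open import Data.Rational.Unnormalised using (mkℚᵘ; *≤*; _≃_) renaming (_≤_ to _≤ᵘ_; _*_ to _*ᵘ_)
  open import Data.Rational.Unnormalised.Properties
    using (≃-refl; ≃-sym; ≃-trans; ≤-respˡ-≃; ≤-respʳ-≃; *-cong)
  open import Data.Product using (∃-syntax; _,_)
  open import Relation.Binary.PropositionalEquality using (_≡_; refl; cong; subst; subst₂; sym; trans)

  positive-numerator : ∀ {n d} .{c : Coprime ℤ.∣ n ∣ (suc d)} → 0ℚ < mkℚ n d c → ∃[ k ] n ≡ + suc k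
  positive-numerator {+[1+ k ]} _   = k , refl
  positive-numerator {+0}       0<γ with () ← positive 0<γ
  positive-numerator { -[1+ _ ]} 0<γ with () ← positive 0<γ

  ℕ/suc≃mkℚᵘ : ∀ a b → toℚᵘ (+ a / suc b) ≃ mkℚᵘ (+ a) b
  ℕ/suc≃mkℚᵘ a b = toℚᵘ-fromℚᵘ (mkℚᵘ (+ a) b)

  mkℚᵘ-*-ℕ : ∀ a b c e → mkℚᵘ (+ a) b *ᵘ mkℚᵘ (+ c) e ≡ mkℚᵘ (+ (a * c)) (e + b * suc e)
  mkℚᵘ-*-ℕ a b c e = cong (λ i → mkℚᵘ i (e + b * suc e)) (sym (ℤ.pos-* a c))

  mkℚᵘ-ℕ-≤⁺ : ∀ {a b c e} → a * suc e ℕ.≤ c * suc b → mkℚᵘ (+ a) b ≤ᵘ mkℚᵘ (+ c) e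
  mkℚᵘ-ℕ-≤⁺ {a} {b} {c} {e} le =
    *≤* (subst₂ ℤ._≤_ (ℤ.pos-* a (suc e)) (ℤ.pos-* c (suc b)) (ℤ.+≤+ le))

  mkℚᵘ-ℕ-≤⁻ : ∀ {a b c e} → mkℚᵘ (+ a) b ≤ᵘ mkℚᵘ (+ c) e → a * suc e ℕ.≤ c * suc b
  mkℚᵘ-ℕ-≤⁻ {a} {b} {c} {e} (*≤* le) =
    ℤ.drop‿+≤+ (subst₂ ℤ._≤_ (sym (ℤ.pos-* a (suc e))) (sym (ℤ.pos-* c (suc b))) le)

  module _ (p d : ℕ) .(c : Coprime p (suc d)) where

    private
      γ : ℚ
      γ = mkℚ (+ p) d c

    γ²-bound⁻ : ∀ X Y → + X / 1 ≤ γ ℚ.* γ ℚ.* (+ Y / 4) → X * (suc d * suc d * 4) ℕ.≤ p * p * Y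
    γ²-bound⁻ X Y X≤γ²Y/4 =
      subst (X * (suc d * suc d * 4) ℕ.≤_) (ℕ.*-identityʳ (p * p * Y)) (mkℚᵘ-ℕ-≤⁻ core)
      where
      γ²Y/4≃ : toℚᵘ (γ ℚ.* γ ℚ.* (+ Y / 4)) ≃ mkℚᵘ (+ p) d *ᵘ mkℚᵘ (+ p) d *ᵘ mkℚᵘ (+ Y) 3
      γ²Y/4≃ = ≃-trans (toℚᵘ-homo-* (γ ℚ.* γ) (+ Y / 4))
                       (*-cong (toℚᵘ-homo-* γ γ) (ℕ/suc≃mkℚᵘ Y 3))
      core : mkℚᵘ (+ X) 0 ≤ᵘ mkℚᵘ (+ (p * p * Y)) (3 + (d + d * suc d) * 4)
      core = subst (mkℚᵘ (+ X) 0 ≤ᵘ_)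
                   (trans (cong (_*ᵘ mkℚᵘ (+ Y) 3) (mkℚᵘ-*-ℕ p d p d))
                          (mkℚᵘ-*-ℕ (p * p) (d + d * suc d) Y 3))
                   (≤-respˡ-≃ (ℕ/suc≃mkℚᵘ X 0) (≤-respʳ-≃ γ²Y/4≃ (toℚᵘ-mono-≤ X≤γ²Y/4)))

    γ-bound⁺ : ∀ C Z → C * suc d ℕ.≤ p * Z → + C / 1 ≤ γ ℚ.* (+ Z / 1)
    γ-bound⁺ C Z Cd≤pZ =
      toℚᵘ-cancel-≤ (≤-respˡ-≃ (≃-sym (ℕ/suc≃mkℚᵘ C 0)) (≤-respʳ-≃ (≃-sym γZ≃) core))
      where
      γZ≃ : toℚᵘ (γ ℚ.* (+ Z / 1)) ≃ mkℚᵘ (+ (p * Z)) (0 + d * 1)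
      γZ≃ = subst (toℚᵘ (γ ℚ.* (+ Z / 1)) ≃_) (mkℚᵘ-*-ℕ p d Z 0)
                  (≃-trans (toℚᵘ-homo-* γ (+ Z / 1)) (*-cong (≃-refl {mkℚᵘ (+ p) d}) (ℕ/suc≃mkℚᵘ Z 0)))
      core : mkℚᵘ (+ C) 0 ≤ᵘ mkℚᵘ (+ (p * Z)) (0 + d * 1)
      core = mkℚᵘ-ℕ-≤⁺ (subst₂ ℕ._≤_ (cong (λ e → C * suc e) (sym (ℕ.*-identityʳ d)))
                                     (sym (ℕ.*-identityʳ (p * Z))) Cd≤pZ)

open import Defs
open import Data.Nat using (ℕ; _*_)
open import Data.Integer using (+_)
open import Data.Rational using (ℚ; 0ℚ; _/_; _≤_; _<_)
open import Data.Fin.Subset using (Subset; ∣_∣; _∪_)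
open import Data.Product using (Σ; _×_)
import Data.Rational as Q

open import Data.Nat using (suc)
open import Data.Rational using (mkℚ)
open import Data.Product using (_,_)
open import Relation.Binary.PropositionalEquality using (refl)
open Repair using (repair)
open Counting using (changesBetween-≤)
open Arithmetic using (cross-multiplied-bound)
open RationalBounds using (positive-numerator; γ²-bound⁻; γ-bound⁺)

lemma2p6 : ∀ {n} (G : OrderedGraph n) (A B : Subset n) (γ : ℚ) →
    Disjoint A B → IsClique G A → IsClique G B → A <ˢ B → 0ℚ < γ →
    (+ countD G (A ∪ B) / 1) ≤ γ Q.* γ Q.* (+ (∣ A ∣ * ∣ A ∣ * ∣ B ∣) / 4) →
    Σ (OrderedGraph n) λ H →
      OnlyChangesBetween G H A B ×
      (+ changesBetween G H A B / 1) ≤ γ Q.* (+ (∣ A ∣ * ∣ B ∣) / 1) ×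
      InducedDFree H (A ∪ B)
lemma2p6 G A B (mkℚ _ d c) A∩B=∅ A-clique B-clique A<B 0<γ X≤γ²|A|²|B|/4 with positive-numerator 0<γ
... | k , refl =
  let H , onlyChanges , αβC≤ , DFree = repair G A∩B=∅ A-clique B-clique A<B (suc k * ∣ A ∣) (2 * suc d)
      C = changesBetween G H A B
      X = countD G (A ∪ B)
      Cd≤k|A||B| = cross-multiplied-bound (suc k) (suc d) ∣ A ∣ ∣ B ∣ C X (changesBetween-≤ A B G H) αβC≤
                                  (γ²-bound⁻ (suc k) d c X (∣ A ∣ * ∣ A ∣ * ∣ B ∣) X≤γ²|A|²|B|/4)
  in H , onlyChanges , γ-bound⁺ (suc k) d c C (∣ A ∣ * ∣ B ∣) Cd≤k|A||B| , DFree
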